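{- Let $n\ge 2$ and $i\ge 0$. If $x^\Lambda\partial_k\in\mathcal{L}_i$, then $r_i>\mathrm{WD}(x^\Lambda\partial_k)$. In particular, if $k<n-r_i+1$, then $\mathcal{L}_i\cap\mathcal{B}_k=\emptyset$.
   Context: Let $n\ge 2$ be an integer. A partition is a sequence $\Lambda=(\lambda_t)_{t\ge 1}$ of non-negative integers with finite support; $\mathrm{wt}(\Lambda)=\sum_t t\lambda_t$; $x^\Lambda=\prod_t x_t^{\lambda_t}$ (monomial in commuting indeterminates), $\deg(x^\Lambda)=\sum_t\lambda_t$. $\mathrm{Part}(j)$ is the set of partitions with $\lambda_t=0$ for $t>j$; $\partial_k$ is the partial derivative with respect to $x_k$. Let $\mathcal{B}=\{x^\Lambda\partial_k:1\le k\le n,\ \Lambda\in\mathrm{Part}(k-1)\}$ and $\mathcal{B}_u=\{x^\Lambda\partial_k\in\mathcal{B}:k=u\}$. For an integer $i\ge -1$ let $r_i\in\{1,\dots,n-1\}$ with $i\equiv r_i\pmod{n-1}$ and $h_i=\lfloor (i-1)/(n-1)\rfloor+1$. For $x^\Lambda\partial_k\in\mathcal{B}$ define $\mathrm{WD}(x^\Lambda\partial_k)=\mathrm{wt}(\Lambda)-\deg(x^\Lambda)+n-k$ and $\mathrm{lev}_i(x^\Lambda\partial_k)=h_i\,\mathrm{WD}(x^\Lambda\partial_k)+\deg(x^\Lambda)-1$. For $i\ge -1$ let $\mathcal{N}_i=\{b\in\mathcal{B}: \mathrm{lev}_j(b)\le j \text{ for some integer } j \text{ with } -1\le j\le i\}$,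 and for $i\ge 0$ let $\mathcal{L}_i=\mathcal{N}_i\setminus\mathcal{N}_{i-1}$. -}

module Defs where

open import Data.Nat as ℕ using (ℕ; zero; suc; _∸_)
open import Data.Integer using (ℤ; +_; -[1+_]; _+_; _-_; _*_; _≤_; _/ℕ_; _%ℕ_)
open import Data.Vec using (Vec; []; _∷_)
open import Data.Product using (Σ; _×_)
open import Relation.Nullary using (¬_)

-- A partition Λ ∈ Part(k-1) is represented by the vector (λ_1, …, λ_{k-1});
-- all λ_t with t > k-1 are 0.

wtFrom : ℕ → ∀ {m} → Vec ℕ m → ℕ
wtFrom t []       = 0
wtFrom t (x ∷ xs) = t ℕ.* x ℕ.+ wtFrom (suc t) xs

wt : ∀ {m} → Vec ℕ m → ℕ
wt = wtFrom 1

deg : ∀ {m} → Vec ℕ m → ℕ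
deg []       = 0
deg (x ∷ xs) = x ℕ.+ deg xs

record Basis (n : ℕ) : Set where
  constructor basis
  field
    k   : ℕ
    1≤k : 1 ℕ.≤ k
    k≤n : k ℕ.≤ n
    Λ   : Vec ℕ (k ∸ 1)

-- The divisor n - 1, written as suc (n ∸ 2) so that it is visibly nonzero;
-- it equals n - 1 whenever n ≥ 2 (the standing assumption).
nm1 : ℕ → ℕ
nm1 n = suc (n ∸ 2)

-- r_i ∈ {1,…,n-1} with i ≡ r_i (mod n-1):  r_i = ((i-1) mod (n-1)) + 1
r : ℕ → ℤ → ℕ
r n i = suc ((i - + 1) %ℕ nm1 n)

-- h_i = ⌊(i-1)/(n-1)⌋ + 1   (/ℕ is floor division for a positive divisor)
h : ℕ → ℤ → ℤ
h n i = ((i - + 1) /ℕ nm1 n) + + 1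

WD : ∀ {n} → Basis n → ℤ
WD {n} b = + wt (Basis.Λ b) - + deg (Basis.Λ b) + + n - + Basis.k b

lev : ∀ {n} → ℤ → Basis n → ℤ
lev {n} i b = h n i * WD b + + deg (Basis.Λ b) - + 1

InN : ∀ {n} → ℤ → Basis n → Set
InN i b = Σ ℤ (λ j → (-[1+ 0 ] ≤ j) × (j ≤ i) × (lev j b ≤ j))

InL : ∀ {n} → ℤ → Basis n → Set
InL i b = InN i b × ¬ InN (i - + 1) b

-- Write i = r_i + (h_i - 1)(n - 1).  For i ≥ 1, if WD(b) ≥ r_i then the level
-- j = (h_i - 1)(n - 1), which lies in [-1, i), has h_j ≤ h_i - 1, so
-- lev_j(b) ≤ lev_i(b) - WD(b) ≤ i - r_i = j and b would already lie in 𝓝_{i-1}.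
-- For i = 0 we have h_0 = 0 and h_{-1} ≤ 0, so lev_0(b) ≤ 0 < lev_{-1}(b) forces
-- deg(x^Λ) = 1; then wt(Λ) ≤ k - 1 and WD(b) ≤ n - 2 < n - 1 = r_0.
-- The second claim follows from WD(b) ≥ n - k.
module Submission where

open import Defs
open import Data.Nat using (ℕ)
open import Data.Integer using (ℤ; +_; _+_; _-_; _≤_; _<_)
open import Data.Product using (_×_)
open import Relation.Binary.PropositionalEquality using (_≡_)
open import Relation.Nullary using (¬_)

import Data.Nat as ℕ
import Data.Nat.Properties as ℕ
open import Data.Nat.DivMod using (_/_)
open import Data.Integer using (-[1+_]; +≤+; +<+; -≤+; -<+; _*_; -_; _/ℕ_; _%ℕ_; nonNegative)
open import Data.Integer.Properties
open import Data.Integer.DivMod using ([n/ℕd]*d≤n; a≡a%ℕn+[a/ℕn]*n)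
open import Data.Integer.Tactic.RingSolver using (solve; solve-∀)
open import Data.List using ([]; _∷_)
-- Vec constructors stay qualified: an ambiguous `_∷_` in the variable lists of `solve` makes it loop.
open import Data.Vec as Vec using (Vec)
open import Data.Product using (_,_)
open import Relation.Binary.PropositionalEquality using (refl; sym; cong; subst; module ≡-Reasoning)
open import Relation.Nullary using (yes; no; contradiction)

deg≤wtFrom : ∀ t {m} (xs : Vec ℕ m) → deg xs ℕ.≤ wtFrom (ℕ.suc t) xs
deg≤wtFrom t Vec.[]       = ℕ.z≤n
deg≤wtFrom t (x Vec.∷ xs) = ℕ.+-mono-≤ (ℕ.m≤m+n x (t ℕ.* x)) (deg≤wtFrom (ℕ.suc t) xs)

wtFrom≤*deg : ∀ t {m} (xs : Vec ℕ m) → wtFrom (ℕ.suc t) xs ℕ.≤ (t ℕ.+ m) ℕ.* deg xs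
wtFrom≤*deg t Vec.[]                 = ℕ.z≤n
wtFrom≤*deg t {ℕ.suc m} (x Vec.∷ xs)
  rewrite ℕ.+-suc t m | ℕ.*-distribˡ-+ (ℕ.suc (t ℕ.+ m)) x (deg xs) =
  ℕ.+-mono-≤ (ℕ.*-monoˡ-≤ x (ℕ.s≤s (ℕ.m≤m+n t m))) (wtFrom≤*deg (ℕ.suc t) xs)

deg≡1⇒wt≤length : ∀ {m} (xs : Vec ℕ m) → deg xs ≡ 1 → wt xs ℕ.≤ m
deg≡1⇒wt≤length {m} xs deg≡1 = begin
  wt xs          ≤⟨ wtFrom≤*deg 0 xs ⟩
  m ℕ.* deg xs   ≡⟨ cong (m ℕ.*_) deg≡1 ⟩
  m ℕ.* 1        ≡⟨ ℕ.*-identityʳ m ⟩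
  m              ∎
  where open ℕ.≤-Reasoning

+-cancelʳ-≤ : ∀ {a b} c → a + c ≤ b + c → a ≤ b
+-cancelʳ-≤ {a} {b} c a+c≤b+c = begin
  a          ≡⟨ solve (a ∷ c ∷ []) ⟩
  a + c - c  ≤⟨ +-monoˡ-≤ (- c) a+c≤b+c ⟩
  b + c - c  ≡⟨ solve (b ∷ c ∷ []) ⟩
  b          ∎
  where open ≤-Reasoning

-1/ℕsuc≡-1 : ∀ d → -[1+ 0 ] /ℕ ℕ.suc d ≡ -[1+ 0 ]
-1/ℕsuc≡-1 ℕ.zero    = refl
-1/ℕsuc≡-1 (ℕ.suc d) = refl

-1%ℕsuc≡d : ∀ d → -[1+ 0 ] %ℕ ℕ.suc d ≡ d
-1%ℕsuc≡d ℕ.zero    = refl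
-1%ℕsuc≡d (ℕ.suc d) = refl

quot : ℕ → ℤ → ℤ
quot n i = (i - + 1) /ℕ nm1 n

r+quot*nm1≡i : ∀ n i → + r n i + quot n i * + nm1 n ≡ i
r+quot*nm1≡i n i = begin
  + 1 + + ρ + q * + nm1 n    ≡⟨ +-assoc (+ 1) (+ ρ) (q * + nm1 n) ⟩
  + 1 + (+ ρ + q * + nm1 n)  ≡⟨ cong (_+_ (+ 1)) (a≡a%ℕn+[a/ℕn]*n (i - + 1) (nm1 n)) ⟨
  + 1 + (i - + 1)            ≡⟨ solve (i ∷ []) ⟩
  i                          ∎
  where
  open ≡-Reasoning
  ρ = (i - + 1) %ℕ nm1 n
  q = quot n i

h≤ : ∀ n {i y} → i ≤ y * + nm1 n → h n i ≤ y
h≤ n {i} {y} i≤y*m = begin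
  quot n i + + 1  ≡⟨ +-comm (quot n i) (+ 1) ⟩
  + 1 + quot n i  ≤⟨ i<j⇒suc[i]≤j quot<y ⟩
  y               ∎
  where
  open ≤-Reasoning
  quot<y : quot n i < y
  quot<y = *-cancelʳ-<-nonNeg (+ nm1 n) (begin-strict
    quot n i * + nm1 n  ≤⟨ [n/ℕd]*d≤n (i - + 1) (nm1 n) ⟩
    i - + 1             <⟨ i≤pred[j]⇒i<j (≤-reflexive (+-comm i (- + 1))) ⟩
    i                   ≤⟨ i≤y*m ⟩
    y * + nm1 n         ∎)

h[0]≡0 : ∀ n → h n (+ 0) ≡ + 0
h[0]≡0 n = cong (_+ + 1) (-1/ℕsuc≡-1 (n ℕ.∸ 2))

r[0]≡nm1 : ∀ n → r n (+ 0) ≡ nm1 n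
r[0]≡nm1 n = cong ℕ.suc (-1%ℕsuc≡d (n ℕ.∸ 2))

InL-minimal : ∀ {n i j} (b : Basis n) → InL i b → -[1+ 0 ] ≤ j → j < i → ¬ lev j b ≤ j
InL-minimal {i = i} {j} _ (_ , ∉N) -1≤j j<i lev≤j = ∉N (j , -1≤j , j≤i-1 , lev≤j)
  where
  j≤i-1 : j ≤ i - + 1
  j≤i-1 = subst (j ≤_) (+-comm (- + 1) i) (i<j⇒i≤pred[j] j<i)

InL⇒lev≤ : ∀ {n i} (b : Basis n) → InL i b → lev i b ≤ i
InL⇒lev≤ {i = i} b L@((j , -1≤j , j≤i , lev≤j) , _) with j ≟ i
... | yes refl = lev≤j
... | no j≢i   = contradiction lev≤j (InL-minimal b L -1≤j (≤∧≢⇒< j≤i j≢i))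

n-k≤WD : ∀ {n} (b : Basis n) → + n - + Basis.k b ≤ WD b
n-k≤WD {n} (basis k _ _ Λ) =
  +-monoˡ-≤ (- + k) (+-monoˡ-≤ (+ n) (i≤j⇒0≤j-i (+≤+ (deg≤wtFrom 0 Λ))))

0≤WD : ∀ {n} (b : Basis n) → + 0 ≤ WD b
0≤WD b = ≤-trans (i≤j⇒0≤j-i (+≤+ (Basis.k≤n b))) (n-k≤WD b)

deg≡1⇒WD<n-1 : ∀ {n} (b : Basis n) → deg (Basis.Λ b) ≡ 1 → WD b < + n - + 1
deg≡1⇒WD<n-1 {n} (basis (ℕ.suc k) _ _ Λ) deg≡1 = begin-strict
  + wt Λ - + deg Λ + + n - + ℕ.suc k  ≡⟨ cong (λ d → + wt Λ - + d + + n - + ℕ.suc k) deg≡1 ⟩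
  + wt Λ - + 1 + + n - + ℕ.suc k      <⟨ +-monoˡ-< (- + ℕ.suc k) (+-monoˡ-< (+ n)
                                           (+-monoˡ-< (- + 1) (+<+ (ℕ.s≤s (deg≡1⇒wt≤length Λ deg≡1))))) ⟩
  + ℕ.suc k - + 1 + + n - + ℕ.suc k   ≡⟨ cancel (+ ℕ.suc k) (+ n) ⟩
  + n - + 1                           ∎
  where
  open ≤-Reasoning
  cancel : ∀ a c → a - + 1 + c - a ≡ c - + 1
  cancel = solve-∀

-- lev i b ≡ levAt (h n i) b: lev_i depends on i only through h_i.
levAt : ∀ {n} → ℤ → Basis n → ℤ
levAt x b = x * WD b + + deg (Basis.Λ b) - + 1

levAt-mono : ∀ {n} (b : Basis n) {x y} → x ≤ y → levAt x b ≤ levAt y b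
levAt-mono b x≤y =
  +-monoˡ-≤ (- + 1) (+-monoˡ-≤ _ (*-monoʳ-≤-nonNeg (WD b) ⦃ nonNegative (0≤WD b) ⦄ x≤y))

levAt-suc : ∀ {n} (b : Basis n) x → levAt (x + + 1) b ≡ levAt x b + WD b
levAt-suc b x = distrib x (WD b) (+ deg (Basis.Λ b))
  where
  distrib : ∀ x w d → (x + + 1) * w + d - + 1 ≡ x * w + d - + 1 + w
  distrib = solve-∀

WD<⇒n-R+1≤k : ∀ {n} (b : Basis n) {R} → WD b < R → + n - R + + 1 ≤ + Basis.k b
WD<⇒n-R+1≤k {n} b {R} WD<R = begin
  + n - R + + 1                  ≡⟨ split (+ n) (+ k) R ⟩
  + 1 + (+ n - + k) + (+ k - R)  ≤⟨ +-monoˡ-≤ (+ k - R) (i<j⇒suc[i]≤j (≤-<-trans (n-k≤WD b) WD<R)) ⟩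
  R + (+ k - R)                  ≡⟨ cancel (+ k) R ⟩
  + k                            ∎
  where
  open ≤-Reasoning
  k = Basis.k b
  split : ∀ a c x → a - x + + 1 ≡ + 1 + (a - c) + (c - x)
  split = solve-∀
  cancel : ∀ c x → x + (c - x) ≡ c
  cancel = solve-∀

InL-zero⇒deg≡1 : ∀ {n} (b : Basis n) → InL (+ 0) b → deg (Basis.Λ b) ≡ 1
InL-zero⇒deg≡1 {n} b L = ℕ.≤-antisym (drop‿+≤+ (i-j≤0⇒i≤j D-1≤0)) (drop‿+≤+ (0≤i-j⇒j≤i 0≤D-1))
  where
  D-1≤0 : + deg (Basis.Λ b) - + 1 ≤ + 0
  D-1≤0 = subst (λ x → levAt x b ≤ + 0) (h[0]≡0 n) (InL⇒lev≤ b L)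
  0≤D-1 : + 0 ≤ + deg (Basis.Λ b) - + 1
  0≤D-1 = ≤-trans (i<j⇒suc[i]≤j (≰⇒> (InL-minimal b L ≤-refl -<+)))
                  (levAt-mono b (h≤ n {y = + 0} -≤+))

InL-zero⇒WD<r : ∀ n → 2 ℕ.≤ n → (b : Basis n) → InL (+ 0) b → WD b < + r n (+ 0)
InL-zero⇒WD<r n@(ℕ.suc (ℕ.suc _)) (ℕ.s≤s (ℕ.s≤s _)) b L =
  subst (λ x → WD b < + x) (sym (r[0]≡nm1 n)) (deg≡1⇒WD<n-1 b (InL-zero⇒deg≡1 b L))

InL-suc⇒WD<r : ∀ {n} t (b : Basis n) → InL (+ ℕ.suc t) b → WD b < + r n (+ ℕ.suc t)
InL-suc⇒WD<r {n} t b L = ≰⇒> λ r≤WD → InL-minimal b L -1≤j j<i (lev≤j r≤WD)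
  where
  open ≤-Reasoning
  i = + ℕ.suc t
  j = quot n i * + nm1 n
  -1≤j : -[1+ 0 ] ≤ j
  -1≤j = subst (-[1+ 0 ] ≤_) (pos-* (t / nm1 n) (nm1 n)) -≤+
  j<i : j < i
  j<i = begin-strict
    j            ≡⟨ +-identityˡ j ⟨
    + 0 + j      <⟨ +-monoˡ-< j (+<+ (ℕ.s≤s ℕ.z≤n)) ⟩
    + r n i + j  ≡⟨ r+quot*nm1≡i n i ⟩
    i            ∎
  lev≤j : + r n i ≤ WD b → lev j b ≤ j
  lev≤j r≤WD = +-cancelʳ-≤ (WD b) (begin
    lev j b + WD b         ≡⟨ levAt-suc b (h n j) ⟨
    levAt (h n j + + 1) b  ≤⟨ levAt-mono b (+-monoˡ-≤ (+ 1) (h≤ n {y = quot n i} ≤-refl)) ⟩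
    lev i b                ≤⟨ InL⇒lev≤ b L ⟩
    i                      ≡⟨ r+quot*nm1≡i n i ⟨
    + r n i + j            ≤⟨ +-monoˡ-≤ j r≤WD ⟩
    WD b + j               ≡⟨ +-comm (WD b) j ⟩
    j + WD b               ∎)

InL⇒WD<r : ∀ n → 2 ℕ.≤ n → ∀ i → + 0 ≤ i → (b : Basis n) → InL i b → WD b < + r n i
InL⇒WD<r n n≥2 (+ 0)       _ = InL-zero⇒WD<r n n≥2
InL⇒WD<r n _   (+ ℕ.suc t) _ = InL-suc⇒WD<r t

proposition2p9 : (n : ℕ) → 2 Data.Nat.≤ n → (i : ℤ) → + 0 ≤ i →
    ((b : Basis n) → InL i b → WD b < + r n i)
    × ((k : ℕ) → + k < + n - + r n i + + 1 →
       (b : Basis n) → Basis.k b ≡ k → ¬ InL i b)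
proposition2p9 n n≥2 i 0≤i = WD<r , outside-L
  where
  WD<r : (b : Basis n) → InL i b → WD b < + r n i
  WD<r = InL⇒WD<r n n≥2 i 0≤i
  outside-L : (k : ℕ) → + k < + n - + r n i + + 1 → (b : Basis n) → Basis.k b ≡ k → ¬ InL i b
  outside-L k k<n-r+1 b refl L = ≤⇒≯ (WD<⇒n-R+1≤k b (WD<r b L)) k<n-r+1
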